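{- The formula $\mathsf{C}p\supset\mathsf{E}\mathsf{C}p$ (with $p$ a propositional variable) does not belong to $\mathbf{QCKL}^{ - }$.
   Context: Language: countable set of variables, $\top,\bot,\land,\neg,\forall$, countably many predicate symbols of each arity (0-ary ones are propositional variables), two modal operators $\mathsf{E},\mathsf{C}$; $\mathsf{E}^n$ denotes the $n$-fold iterate. $\mathbf{QCKL}^{ - }$ is the set of formulas derivable from: all classical predicate tautologies; $\Box(p\supset q)\supset(\Box p\supset\Box q)$ for $\Box\in\{\mathsf{E},\mathsf{C}\}$; $\mathsf{C}p\supset\mathsf{E}^np$ for each $n\in\omega$; modus ponens; uniform substitution; necessitation for $\mathsf{E}$ and $\mathsf{C}$; generalization; and the $\omega$-rule: from $\gamma\supset\mathsf{E}^n\phi$ for all $n\in\omega$ infer $\gamma\supset\mathsf{C}\phi$. -}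

module Defs where

open import Data.Nat using (ℕ; zero; suc; _+_; _≡ᵇ_)
open import Data.Bool using (Bool; true; false; _∧_; not; if_then_else_)
open import Data.Vec using (Vec; []; _∷_; map)
open import Relation.Binary.PropositionalEquality using (_≡_)
open import Relation.Nullary using (¬_)

-- Object variables are de Bruijn indices (ℕ): index i under d binders
-- refers to the (i - d)-th free variable.  This is a capture-free
-- presentation of a countable set of variables.

-- Formulas.  'atom n P ys' is the n-ary predicate symbol number P
-- applied to the variables ys; 0-ary atoms are propositional variables.
data Fm : Set where
  atom : (n : ℕ) → ℕ → Vec ℕ n → Fm
  ⊤'   : Fm
  ⊥'   : Fm
  _∧'_ : Fm → Fm → Fm
  ¬'_  : Fm → Fm
  ∀'_  : Fm → Fm
  E_   : Fm → Fm
  C_   : Fm → Fm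

infixr 6 _∧'_
infix 7 ¬'_ ∀'_ E_ C_
infixr 5 _⊃_

_⊃_ : Fm → Fm → Fm
φ ⊃ ψ = ¬' (φ ∧' ¬' ψ)

E^ : ℕ → Fm → Fm
E^ zero φ = φ
E^ (suc n) φ = E (E^ n φ)

p q : Fm
p = atom 0 0 []
q = atom 0 1 []

lift : (ℕ → ℕ) → ℕ → ℕ
lift ρ zero = zero
lift ρ (suc i) = suc (ρ i)

rename : (ℕ → ℕ) → Fm → Fm
rename ρ (atom n P ys) = atom n P (map ρ ys)
rename ρ ⊤' = ⊤'
rename ρ ⊥' = ⊥'
rename ρ (φ ∧' ψ) = rename ρ φ ∧' rename ρ ψ
rename ρ (¬' φ) = ¬' rename ρ φ
rename ρ (∀' φ) = ∀' rename (lift ρ) φ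
rename ρ (E φ) = E rename ρ φ
rename ρ (C φ) = C rename ρ φ

-- instantiate the bound variable 0 by the free variable y : φ[y/x]
inst0 : ℕ → ℕ → ℕ
inst0 y zero = y
inst0 y (suc i) = i

-- abstract the free variable k: ∀' (rename (abstr k) φ) is ∀x_k φ
abstr : ℕ → ℕ → ℕ
abstr k i = if i ≡ᵇ k then zero else suc i

-- Uniform substitution (of formulas for predicate symbols)
-- σ n P is the formula replacing the n-ary predicate symbol P; its free
-- indices 0..n-1 are the argument places and index n+j is the j-th
-- free parameter variable.

sel : ∀ {n} → Vec ℕ n → ℕ → ℕ → ℕ
sel [] d i = i + d
sel (y ∷ ys) d zero = y
sel (y ∷ ys) d (suc i) = sel ys d i

Subst : Set
Subst = (n : ℕ) → ℕ → Fm

usub : Subst → ℕ → Fm → Fm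
usub σ d (atom n P ys) = rename (sel ys d) (σ n P)
usub σ d ⊤' = ⊤'
usub σ d ⊥' = ⊥'
usub σ d (φ ∧' ψ) = usub σ d φ ∧' usub σ d ψ
usub σ d (¬' φ) = ¬' usub σ d φ
usub σ d (∀' φ) = ∀' usub σ (suc d) φ
usub σ d (E φ) = E usub σ d φ
usub σ d (C φ) = C usub σ d φ

-- Classical propositional tautologies (prime formulas: atoms,
-- quantified and modal formulas)

eval : (Fm → Bool) → Fm → Bool
eval v ⊤' = true
eval v ⊥' = false
eval v (φ ∧' ψ) = eval v φ ∧ eval v ψ
eval v (¬' φ) = not (eval v φ)
eval v φ = v φ

Taut : Fm → Set
Taut φ = (v : Fm → Bool) → eval v φ ≡ true

data ⊢_ : Fm → Set where
  -- classical predicate tautologies: propositional tautologies plus the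
  -- standard quantifier axioms (with Gen and MP this yields exactly the
  -- first-order valid formulas)
  taut  : ∀ {φ} → Taut φ → ⊢ φ
  ax∀E  : ∀ φ y → ⊢ (∀' φ ⊃ rename (inst0 y) φ)
  ax∀K  : ∀ φ ψ → ⊢ (∀' (φ ⊃ ψ) ⊃ (∀' φ ⊃ ∀' ψ))
  ax∀I  : ∀ φ → ⊢ (φ ⊃ ∀' rename suc φ)
  axKE  : ⊢ (E (p ⊃ q) ⊃ (E p ⊃ E q))
  axKC  : ⊢ (C (p ⊃ q) ⊃ (C p ⊃ C q))
  axCE  : ∀ n → ⊢ (C p ⊃ E^ n p)
  mp    : ∀ {φ ψ} → ⊢ (φ ⊃ ψ) → ⊢ φ → ⊢ ψ
  usubR : ∀ {φ} (σ : Subst) → ⊢ φ → ⊢ usub σ 0 φ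
  necE  : ∀ {φ} → ⊢ φ → ⊢ E φ
  necC  : ∀ {φ} → ⊢ φ → ⊢ C φ
  gen   : ∀ {φ} k → ⊢ φ → ⊢ ∀' rename (abstr k) φ
  ωrule : ∀ {γ φ} → ((n : ℕ) → ⊢ (γ ⊃ E^ n φ)) → ⊢ (γ ⊃ C φ)

infix 3 ⊢_

-- The theorem is proved by a soundness argument for a model with worlds 0, 1, 2, … and a limit
-- world ω. E looks one step down along the finite worlds (world 0 sees nothing), and at ω it looks
-- at the eventual value of its argument; this is well defined because every formula is eventually
-- constant along the finite worlds. At every world C φ is equivalent to the conjunction of all
-- E^n φ, which makes the ω-rule and the C-axioms sound. But E (C φ) at ω only asks that C φ be
-- eventually true, i.e. that φ hold at all finite worlds. So if p fails at world 0 and holds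
-- everywhere else, including ω, then C p holds at ω while E (C p) fails there.
module Submission where

open import Defs
open import Data.Bool using (Bool; true; false; _∧_; not; T)
open import Data.Bool.Properties using (T-≡; T-∧; ∧-assoc; ∧-idem)
open import Data.Nat using (ℕ; zero; suc; _+_; _≤_; s≤s; _≤′_; ≤′-refl; ≤′-step)
open import Data.Nat.Properties using (≤-refl; ≤-trans; m≤m+n; m≤n+m; m≤n⇒m≤1+n; ≤⇒≤′; ≤′⇒≤)
open import Data.Product using (_,_; proj₁; proj₂)
open import Data.Unit using (tt)
open import Function using (_⇔_; mk⇔; Equivalence)
open import Relation.Binary.PropositionalEquality
  using (_≡_; refl; sym; trans; cong; cong₂; subst; module ≡-Reasoning)
open import Relation.Nullary using (¬_)

open Equivalence using (to; from)

T-⊃ : ∀ {x y} → T (not (x ∧ not y)) ⇔ (T x → T y)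
T-⊃ {false} {y}     = mk⇔ (λ _ ()) (λ _ → tt)
T-⊃ {true}  {false} = mk⇔ (λ ()) (λ h → h tt)
T-⊃ {true}  {true}  = mk⇔ (λ _ _ → tt) (λ _ → tt)

all≤ : (ℕ → Bool) → ℕ → Bool
all≤ g zero    = g zero
all≤ g (suc k) = all≤ g k ∧ g (suc k)

all≤-∧-last : ∀ g n → all≤ g n ∧ g n ≡ all≤ g n
all≤-∧-last g zero    = ∧-idem (g zero)
all≤-∧-last g (suc n) = trans (∧-assoc (all≤ g n) _ _) (cong (all≤ g n ∧_) (∧-idem (g (suc n))))

all≤-stable : ∀ {g n b} → (∀ {k} → n ≤ k → g k ≡ b) → ∀ {k} → n ≤ k → all≤ g k ≡ all≤ g n
all≤-stable {g} {n} {b} g-stable n≤k = go (≤⇒≤′ n≤k)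
  where
  open ≡-Reasoning
  go : ∀ {k} → n ≤′ k → all≤ g k ≡ all≤ g n
  go ≤′-refl = refl
  go (≤′-step {k} n≤′k) = begin
    all≤ g k ∧ g (suc k)  ≡⟨ cong₂ _∧_ (go n≤′k) (g-stable (m≤n⇒m≤1+n (≤′⇒≤ n≤′k))) ⟩
    all≤ g n ∧ b          ≡⟨ cong (all≤ g n ∧_) (sym (g-stable ≤-refl)) ⟩
    all≤ g n ∧ g n        ≡⟨ all≤-∧-last g n ⟩
    all≤ g n              ∎

record Val : Set where
  -- keeps the implicit Val arguments of the lemmas below inferable from their types
  no-eta-equality
  field
    atℕ    : ℕ → Bool
    atω    : Bool
    limit  : Bool
    stage  : ℕ
    stable : ∀ {k} → stage ≤ k → atℕ k ≡ limit
open Val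

constᵛ : Bool → Val
constᵛ b .atℕ _    = b
constᵛ b .atω      = b
constᵛ b .limit    = b
constᵛ b .stage    = 0
constᵛ b .stable _ = refl

infixr 6 _∧ᵛ_
infix 7 ¬ᵛ_
infixr 5 _⊃ᵛ_

_∧ᵛ_ : Val → Val → Val
(a ∧ᵛ b) .atℕ k = a .atℕ k ∧ b .atℕ k
(a ∧ᵛ b) .atω   = a .atω ∧ b .atω
(a ∧ᵛ b) .limit = a .limit ∧ b .limit
(a ∧ᵛ b) .stage = a .stage + b .stage
(a ∧ᵛ b) .stable le =
  cong₂ _∧_ (a .stable (≤-trans (m≤m+n _ _) le)) (b .stable (≤-trans (m≤n+m _ _) le))

¬ᵛ_ : Val → Val
(¬ᵛ a) .atℕ k     = not (a .atℕ k)
(¬ᵛ a) .atω       = not (a .atω)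
(¬ᵛ a) .limit     = not (a .limit)
(¬ᵛ a) .stage     = a .stage
(¬ᵛ a) .stable le = cong not (a .stable le)

_⊃ᵛ_ : Val → Val → Val
a ⊃ᵛ b = ¬ᵛ (a ∧ᵛ ¬ᵛ b)

Eᵛ : Val → Val
Eᵛ a .atℕ zero                = true
Eᵛ a .atℕ (suc k)             = a .atℕ k
Eᵛ a .atω                     = a .limit
Eᵛ a .limit                   = a .limit
Eᵛ a .stage                   = suc (a .stage)
Eᵛ a .stable {suc k} (s≤s le) = a .stable le

Eᵛ^ : ℕ → Val → Val
Eᵛ^ zero    a = a
Eᵛ^ (suc n) a = Eᵛ (Eᵛ^ n a)

Cᵛ : Val → Val
Cᵛ a .atℕ    = all≤ (a .atℕ)
Cᵛ a .atω    = a .atω ∧ a .limit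
Cᵛ a .limit  = all≤ (a .atℕ) (a .stage)
Cᵛ a .stage  = a .stage
Cᵛ a .stable = all≤-stable (a .stable)

limit-Eᵛ^ : ∀ n a → Eᵛ^ n a .limit ≡ a .limit
limit-Eᵛ^ zero    a = refl
limit-Eᵛ^ (suc n) a = limit-Eᵛ^ n a

data World : Set where
  fin : ℕ → World
  ω   : World

at : Val → World → Bool
at a (fin k) = a .atℕ k
at a ω       = a .atω

holds : Val → World → Set
holds a x = T (at a x)

Valid : Val → Set
Valid a = ∀ x → holds a x

at-∧ᵛ : ∀ a b x → at (a ∧ᵛ b) x ≡ at a x ∧ at b x
at-∧ᵛ a b (fin k) = refl
at-∧ᵛ a b ω       = refl

at-¬ᵛ : ∀ a x → at (¬ᵛ a) x ≡ not (at a x)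
at-¬ᵛ a (fin k) = refl
at-¬ᵛ a ω       = refl

holds-⊃ᵛ : ∀ {a b} x → holds (a ⊃ᵛ b) x ⇔ (holds a x → holds b x)
holds-⊃ᵛ (fin k) = T-⊃
holds-⊃ᵛ ω       = T-⊃

⊃ᵛ-intro : ∀ {a b} → (∀ x → holds a x → holds b x) → Valid (a ⊃ᵛ b)
⊃ᵛ-intro h x = from (holds-⊃ᵛ x) (h x)

⊃ᵛ-intro₂ : ∀ {a b c} → (∀ x → holds a x → holds b x → holds c x) → Valid (a ⊃ᵛ b ⊃ᵛ c)
⊃ᵛ-intro₂ h = ⊃ᵛ-intro (λ x ha → from (holds-⊃ᵛ x) (h x ha))

⊃ᵛ-refl : ∀ {a} → Valid (a ⊃ᵛ a)
⊃ᵛ-refl = ⊃ᵛ-intro (λ _ h → h)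

Eᵛ^-mp : ∀ n {a b} x → holds (Eᵛ^ n (a ⊃ᵛ b)) x → holds (Eᵛ^ n a) x → holds (Eᵛ^ n b) x
Eᵛ^-mp zero    x                 = to (holds-⊃ᵛ x)
Eᵛ^-mp (suc n) (fin zero)    _ _ = tt
Eᵛ^-mp (suc n) (fin (suc k))     = Eᵛ^-mp n (fin k)
Eᵛ^-mp (suc n) {a} {b} ω h ha    = subst T (sym (limit-Eᵛ^ n b))
  (to T-⊃ (subst T (limit-Eᵛ^ n (a ⊃ᵛ b)) h) (subst T (limit-Eᵛ^ n a) ha))

all≤-last : ∀ g k → T (all≤ g k) → T (g k)
all≤-last g zero    h = h
all≤-last g (suc k) h = proj₂ (to T-∧ h)

all≤⇔Eᵛ^ : ∀ a k → T (all≤ (a .atℕ) k) ⇔ (∀ n → holds (Eᵛ^ n a) (fin k))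
all≤⇔Eᵛ^ a k = mk⇔ (λ h n → below n k h) (above k)
  where
  below : ∀ n k → T (all≤ (a .atℕ) k) → holds (Eᵛ^ n a) (fin k)
  below zero    k       h = all≤-last (a .atℕ) k h
  below (suc n) zero    _ = tt
  below (suc n) (suc k) h = below n k (proj₁ (to T-∧ h))
  above : ∀ k → (∀ n → holds (Eᵛ^ n a) (fin k)) → T (all≤ (a .atℕ) k)
  above zero    h = h 0
  above (suc k) h = from T-∧ (above k (λ n → h (suc n)) , h 0)

holds-Cᵛ : ∀ a x → holds (Cᵛ a) x ⇔ (∀ n → holds (Eᵛ^ n a) x)
holds-Cᵛ a (fin k) = all≤⇔Eᵛ^ a k
holds-Cᵛ a ω       = mk⇔ every (λ h → from T-∧ (h 0 , h 1))
  where
  every : holds (Cᵛ a) ω → ∀ n → holds (Eᵛ^ n a) ω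
  every h zero    = proj₁ (to T-∧ h)
  every h (suc n) = subst T (sym (limit-Eᵛ^ n a)) (proj₂ (to T-∧ h))

Eᵛ-valid : ∀ {a} → Valid a → Valid (Eᵛ a)
Eᵛ-valid v (fin zero)    = tt
Eᵛ-valid v (fin (suc k)) = v (fin k)
Eᵛ-valid {a} v ω         = subst T (a .stable ≤-refl) (v (fin (a .stage)))

Eᵛ^-valid : ∀ n {a} → Valid a → Valid (Eᵛ^ n a)
Eᵛ^-valid zero    v = v
Eᵛ^-valid (suc n) v = Eᵛ-valid (Eᵛ^-valid n v)

Cᵛ-valid : ∀ {a} → Valid a → Valid (Cᵛ a)
Cᵛ-valid {a} v x = from (holds-Cᵛ a x) (λ n → Eᵛ^-valid n v x)

Env : Set
Env = (n : ℕ) → ℕ → Val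

-- Quantifiers range over a one-element domain, so they are transparent and variables are irrelevant.
sem : Env → Fm → Val
sem ρ (atom n P ys) = ρ n P
sem ρ ⊤'            = constᵛ true
sem ρ ⊥'            = constᵛ false
sem ρ (φ ∧' ψ)      = sem ρ φ ∧ᵛ sem ρ ψ
sem ρ (¬' φ)        = ¬ᵛ sem ρ φ
sem ρ (∀' φ)        = sem ρ φ
sem ρ (E φ)         = Eᵛ (sem ρ φ)
sem ρ (C φ)         = Cᵛ (sem ρ φ)

sem-rename : ∀ ρ r φ → sem ρ (rename r φ) ≡ sem ρ φ
sem-rename ρ r (atom n P ys) = refl
sem-rename ρ r ⊤'            = refl
sem-rename ρ r ⊥'            = refl
sem-rename ρ r (φ ∧' ψ)      = cong₂ _∧ᵛ_ (sem-rename ρ r φ) (sem-rename ρ r ψ)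
sem-rename ρ r (¬' φ)        = cong ¬ᵛ_ (sem-rename ρ r φ)
sem-rename ρ r (∀' φ)        = sem-rename ρ (lift r) φ
sem-rename ρ r (E φ)         = cong Eᵛ (sem-rename ρ r φ)
sem-rename ρ r (C φ)         = cong Cᵛ (sem-rename ρ r φ)

sem-usub : ∀ ρ σ d φ → sem ρ (usub σ d φ) ≡ sem (λ n P → sem ρ (σ n P)) φ
sem-usub ρ σ d (atom n P ys) = sem-rename ρ (sel ys d) (σ n P)
sem-usub ρ σ d ⊤'            = refl
sem-usub ρ σ d ⊥'            = refl
sem-usub ρ σ d (φ ∧' ψ)      = cong₂ _∧ᵛ_ (sem-usub ρ σ d φ) (sem-usub ρ σ d ψ)
sem-usub ρ σ d (¬' φ)        = cong ¬ᵛ_ (sem-usub ρ σ d φ)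
sem-usub ρ σ d (∀' φ)        = sem-usub ρ σ (suc d) φ
sem-usub ρ σ d (E φ)         = cong Eᵛ (sem-usub ρ σ d φ)
sem-usub ρ σ d (C φ)         = cong Cᵛ (sem-usub ρ σ d φ)

sem-E^ : ∀ ρ n φ → sem ρ (E^ n φ) ≡ Eᵛ^ n (sem ρ φ)
sem-E^ ρ zero    φ = refl
sem-E^ ρ (suc n) φ = cong Eᵛ (sem-E^ ρ n φ)

eval-sem : ∀ ρ x φ → eval (λ ψ → at (sem ρ ψ) x) φ ≡ at (sem ρ φ) x
eval-sem ρ x (atom n P ys) = refl
eval-sem ρ (fin k) ⊤'      = refl
eval-sem ρ ω ⊤'            = refl
eval-sem ρ (fin k) ⊥'      = refl
eval-sem ρ ω ⊥'            = refl
eval-sem ρ x (φ ∧' ψ)      =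
  trans (cong₂ _∧_ (eval-sem ρ x φ) (eval-sem ρ x ψ)) (sym (at-∧ᵛ (sem ρ φ) (sem ρ ψ) x))
eval-sem ρ x (¬' φ)        = trans (cong not (eval-sem ρ x φ)) (sym (at-¬ᵛ (sem ρ φ) x))
eval-sem ρ x (∀' φ)        = refl
eval-sem ρ x (E φ)         = refl
eval-sem ρ x (C φ)         = refl

sound : ∀ {φ} → ⊢ φ → ∀ ρ → Valid (sem ρ φ)
sound {φ} (taut t) ρ x = from T-≡ (trans (sym (eval-sem ρ x φ)) (t _))
sound (ax∀E φ y) ρ rewrite sem-rename ρ (inst0 y) φ = ⊃ᵛ-refl
sound (ax∀K φ ψ) ρ = ⊃ᵛ-refl
sound (ax∀I φ) ρ rewrite sem-rename ρ suc φ = ⊃ᵛ-refl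
sound axKE ρ = ⊃ᵛ-intro₂ (Eᵛ^-mp 1)
sound axKC ρ = ⊃ᵛ-intro₂ λ x h hp →
  from (holds-Cᵛ _ x) λ n → Eᵛ^-mp n x (to (holds-Cᵛ _ x) h n) (to (holds-Cᵛ _ x) hp n)
sound (axCE n) ρ rewrite sem-E^ ρ n p = ⊃ᵛ-intro λ x h → to (holds-Cᵛ _ x) h n
sound (mp d e) ρ x = to (holds-⊃ᵛ x) (sound d ρ x) (sound e ρ x)
sound (usubR {φ} σ d) ρ rewrite sem-usub ρ σ 0 φ = sound d _
sound (necE d) ρ = Eᵛ-valid (sound d ρ)
sound (necC d) ρ = Cᵛ-valid (sound d ρ)
sound (gen {φ} k d) ρ rewrite sem-rename ρ (abstr k) φ = sound d ρ
sound (ωrule {γ} {φ} h) ρ = ⊃ᵛ-intro λ x hγ →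
  from (holds-Cᵛ _ x) λ n →
    to (holds-⊃ᵛ x) (subst (λ a → Valid (sem ρ γ ⊃ᵛ a)) (sem-E^ ρ n φ) (sound (h n) ρ) x) hγ

falseOnlyAt0 : Val
falseOnlyAt0 .atℕ zero         = false
falseOnlyAt0 .atℕ (suc _)      = true
falseOnlyAt0 .atω              = true
falseOnlyAt0 .limit            = true
falseOnlyAt0 .stage            = 1
falseOnlyAt0 .stable {suc _} _ = refl

corollary7p6 : ¬ (⊢ (C p ⊃ E (C p)))
corollary7p6 ⊢CE = to (holds-⊃ᵛ {Cᵛ falseOnlyAt0} {Eᵛ (Cᵛ falseOnlyAt0)} ω)
                      (sound ⊢CE (λ _ _ → falseOnlyAt0) ω) tt
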